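{- For every $d\in\mathbb{N}$, $w_p(d+1)\ge w_p(d)$ and $w_s(d+1)\ge w_s(d)$.
   Context: A lattice polytope in $\mathbb{R}^d$ has its vertices in $\mathbb{Z}^d$; it is hollow if its interior contains no point of $\mathbb{Z}^d$. The lattice width of $K\subset\mathbb{R}^d$ is $\inf_{f\in(\mathbb{Z}^d)^*\setminus\{0\}}(\max_K f-\min_K f)$. $w_p(d)$ is the maximum lattice width of hollow lattice $d$-polytopes, and $w_s(d)$ the maximum lattice width of hollow lattice $d$-simplices. -}

module Defs where

open import Data.Nat using (ℕ; suc)
open import Data.Fin using (Fin; zero; suc)
open import Data.Integer as ℤ using (ℤ; +_)
open import Data.Rational as ℚ using (ℚ; 0ℚ; 1ℚ)
open import Data.Product using (Σ; _×_; ∃)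
open import Relation.Binary.PropositionalEquality using (_≡_)
open import Relation.Nullary using (¬_)

-- Points of ℤ^d and ℚ^d, integer linear functionals on ℝ^d (= elements of (ℤ^d)^*).
Pt : ℕ → Set
Pt d = Fin d → ℤ

QPt : ℕ → Set
QPt d = Fin d → ℚ

ℤtoℚ : ℤ → ℚ
ℤtoℚ i = i ℚ./ 1

sumℤ : ∀ {n} → (Fin n → ℤ) → ℤ
sumℤ {ℕ.zero} f = + 0
sumℤ {suc n} f = f zero ℤ.+ sumℤ (λ i → f (suc i))

sumℚ : ∀ {n} → (Fin n → ℚ) → ℚ
sumℚ {ℕ.zero} f = 0ℚ
sumℚ {suc n} f = f zero ℚ.+ sumℚ (λ i → f (suc i))

maxℤ : ∀ {n} → (Fin (suc n) → ℤ) → ℤ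
maxℤ {ℕ.zero} f = f zero
maxℤ {suc n} f = f zero ℤ.⊔ maxℤ (λ i → f (suc i))

minℤ : ∀ {n} → (Fin (suc n) → ℤ) → ℤ
minℤ {ℕ.zero} f = f zero
minℤ {suc n} f = f zero ℤ.⊓ minℤ (λ i → f (suc i))

ev : ∀ {d} → Pt d → Pt d → ℤ
ev f v = sumℤ (λ k → f k ℤ.* v k)

NonZeroFun : ∀ {d} → Pt d → Set
NonZeroFun f = ¬ (∀ k → f k ≡ + 0)

-- A lattice polytope in ℝ^d is given as conv(V) of a nonempty finite
-- family V : Fin (suc n) → ℤ^d of lattice points.

InConv : ∀ {d n} → (Fin (suc n) → Pt d) → QPt d → Set
InConv {d} {n} V y =
  Σ (Fin (suc n) → ℚ) λ λs →
    (∀ i → 0ℚ ℚ.≤ λs i) × (sumℚ λs ≡ 1ℚ) ×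
    (∀ k → sumℚ (λ i → λs i ℚ.* ℤtoℚ (V i k)) ≡ y k)

InAff : ∀ {d n} → (Fin (suc n) → Pt d) → QPt d → Set
InAff {d} {n} V y =
  Σ (Fin (suc n) → ℚ) λ λs →
    (sumℚ λs ≡ 1ℚ) ×
    (∀ k → sumℚ (λ i → λs i ℚ.* ℤtoℚ (V i k)) ≡ y k)

-- conv(V) is a d-polytope: its affine hull is all of ℝ^d (tested on ℚ^d)
FullDim : ∀ {d n} → (Fin (suc n) → Pt d) → Set
FullDim {d} V = ∀ (y : QPt d) → InAff V y

-- the point z lies in the interior of conv(V): some box (sup-norm ball)
-- of positive radius ε around z is contained in conv(V) (tested on ℚ^d)
InInterior : ∀ {d n} → (Fin (suc n) → Pt d) → QPt d → Set
InInterior {d} V z =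
  Σ ℚ λ ε → (0ℚ ℚ.< ε) ×
    (∀ (y : QPt d) → (∀ k → ℚ.∣ y k ℚ.- z k ∣ ℚ.< ε) → InConv V y)

Hollow : ∀ {d n} → (Fin (suc n) → Pt d) → Set
Hollow {d} V = ∀ (z : Pt d) → ¬ InInterior V (λ k → ℤtoℚ (z k))

-- max_{conv V} f − min_{conv V} f (attained at points of V)
spread : ∀ {d n} → (Fin (suc n) → Pt d) → Pt d → ℤ
spread V f = maxℤ (λ i → ev f (V i)) ℤ.- minℤ (λ i → ev f (V i))

HasWidth : ∀ {d n} → (Fin (suc n) → Pt d) → ℤ → Set
HasWidth {d} V w =
  (Σ (Pt d) λ f → NonZeroFun f × (spread V f ≡ w)) ×
  (∀ (f : Pt d) → NonZeroFun f → w ℤ.≤ spread V f)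

HollowPolytope : ℕ → Set
HollowPolytope d = Σ ℕ λ n → Σ (Fin (suc n) → Pt d) λ V → FullDim V × Hollow V

-- hollow lattice d-simplex: conv of d+1 lattice points, full-dimensional
HollowSimplex : ℕ → Set
HollowSimplex d = Σ (Fin (suc d) → Pt d) λ V → FullDim V × Hollow V

IsWp : ℕ → ℤ → Set
IsWp d w =
  (Σ (HollowPolytope d) λ P → HasWidth (Data.Product.proj₁ (Data.Product.proj₂ P)) w) ×
  (∀ (P : HollowPolytope d) (w′ : ℤ) →
     HasWidth (Data.Product.proj₁ (Data.Product.proj₂ P)) w′ → w′ ℤ.≤ w)

IsWs : ℕ → ℤ → Set
IsWs d w =
  (Σ (HollowSimplex d) λ S → HasWidth (Data.Product.proj₁ S) w) ×
  (∀ (S : HollowSimplex d) (w′ : ℤ) →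
     HasWidth (Data.Product.proj₁ S) w′ → w′ ℤ.≤ w)

module Submission where

open import Defs
open import Data.Nat using (ℕ; suc)
open import Data.Integer using (ℤ; _≤_)
open import Data.Product using (_×_)

import Data.Nat as ℕ
import Data.Nat.Properties as ℕP
import Data.Nat.Coprimality as Coprimality
open import Data.Fin using (Fin; zero; suc)
open import Data.Fin.Properties using (all?)
open import Data.Vec.Functional using (_∷_; tail)
import Data.Integer as ℤ
open import Data.Integer using (+_; -[1+_]; +[1+_])
import Data.Integer.Properties as ℤP
import Data.Rational as ℚ
open import Data.Rational using (ℚ; 0ℚ; mkℚ)
import Data.Rational.Properties as ℚP
open import Data.Rational.Solver using (module +-*-Solver)
open import Data.Product using (_,_)
open import Data.Sum using (inj₁; inj₂)
open import Relation.Binary.PropositionalEquality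
open import Relation.Nullary using (yes; no)

-- Over a hollow lattice d-polytope P of width w put the pyramid with apex at
-- height h ≥ w above a vertex of P. Its projection to ℝ^d is P, so an interior
-- lattice point of the pyramid would project to one of P; a functional with a
-- nonzero horizontal part is at least as wide on the pyramid as on P, and the
-- vertical functionals have width a nonzero multiple of h. The pyramid over a
-- simplex is a simplex.

pyramid : ∀ {d n} → ℤ → (Fin (suc n) → Pt d) → Fin (suc (suc n)) → Pt (suc d)
pyramid h V = (h ∷ V zero) ∷ λ i → + 0 ∷ V i

rangeℤ : ∀ {n} → (Fin (suc n) → ℤ) → ℤ
rangeℤ g = maxℤ g ℤ.- minℤ g

maxℤ-cong : ∀ {n} {g h : Fin (suc n) → ℤ} → (∀ i → g i ≡ h i) → maxℤ g ≡ maxℤ h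
maxℤ-cong {ℕ.zero} g≗h = g≗h zero
maxℤ-cong {suc n} g≗h = cong₂ ℤ._⊔_ (g≗h zero) (maxℤ-cong (λ i → g≗h (suc i)))

minℤ-cong : ∀ {n} {g h : Fin (suc n) → ℤ} → (∀ i → g i ≡ h i) → minℤ g ≡ minℤ h
minℤ-cong {ℕ.zero} g≗h = g≗h zero
minℤ-cong {suc n} g≗h = cong₂ ℤ._⊓_ (g≗h zero) (minℤ-cong (λ i → g≗h (suc i)))

rangeℤ-cong : ∀ {n} {g h : Fin (suc n) → ℤ} → (∀ i → g i ≡ h i) → rangeℤ g ≡ rangeℤ h
rangeℤ-cong g≗h = cong₂ ℤ._-_ (maxℤ-cong g≗h) (minℤ-cong g≗h)

≤-maxℤ : ∀ {n} (g : Fin (suc n) → ℤ) i → g i ≤ maxℤ g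
≤-maxℤ {ℕ.zero} g zero = ℤP.≤-refl
≤-maxℤ {suc n} g zero = ℤP.i≤i⊔j _ _
≤-maxℤ {suc n} g (suc i) = ℤP.≤-trans (≤-maxℤ (tail g) i) (ℤP.i≤j⊔i _ _)

minℤ-≤ : ∀ {n} (g : Fin (suc n) → ℤ) i → minℤ g ≤ g i
minℤ-≤ {ℕ.zero} g zero = ℤP.≤-refl
minℤ-≤ {suc n} g zero = ℤP.i⊓j≤i _ _
minℤ-≤ {suc n} g (suc i) = ℤP.≤-trans (ℤP.i⊓j≤j _ _) (minℤ-≤ (tail g) i)

-≤-rangeℤ : ∀ {n} (g : Fin (suc n) → ℤ) i j → g i ℤ.- g j ≤ rangeℤ g
-≤-rangeℤ g i j = ℤP.+-mono-≤ (≤-maxℤ g i) (ℤP.neg-mono-≤ (minℤ-≤ g j))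

∣-∣≤rangeℤ : ∀ {n} (g : Fin (suc n) → ℤ) i j → + ℤ.∣ g i ℤ.- g j ∣ ≤ rangeℤ g
∣-∣≤rangeℤ g i j with ℤP.≤-total (g i) (g j)
... | inj₁ gi≤gj = subst (_≤ rangeℤ g) (sym (ℤP.∣-∣-≤ gi≤gj)) (-≤-rangeℤ g j i)
... | inj₂ gj≤gi = subst (_≤ rangeℤ g)
        (sym (trans (cong +_ (ℤP.∣i-j∣≡∣j-i∣ (g i) (g j))) (ℤP.∣-∣-≤ gj≤gi)))
        (-≤-rangeℤ g i j)

rangeℤ-tail-≤ : ∀ {n} (g : Fin (suc (suc n)) → ℤ) → rangeℤ (tail g) ≤ rangeℤ g
rangeℤ-tail-≤ g = ℤP.+-mono-≤ (ℤP.i≤j⊔i (g zero) _) (ℤP.neg-mono-≤ (ℤP.i⊓j≤j (g zero) _))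

rangeℤ-duplicate-head : ∀ {n} (g : Fin (suc n) → ℤ) → rangeℤ (g zero ∷ g) ≡ rangeℤ g
rangeℤ-duplicate-head g =
  cong₂ ℤ._-_ (ℤP.i≤j⇒i⊔j≡j (≤-maxℤ g zero)) (ℤP.i≥j⇒i⊓j≡j (minℤ-≤ g zero))

sumℤ-zero : ∀ {n} (g : Fin n → ℤ) → (∀ i → g i ≡ + 0) → sumℤ g ≡ + 0
sumℤ-zero {ℕ.zero} g g≗0 = refl
sumℤ-zero {suc n} g g≗0 = cong₂ ℤ._+_ (g≗0 zero) (sumℤ-zero (tail g) (λ i → g≗0 (suc i)))

ev-zero : ∀ {d} (f v : Pt d) → (∀ k → f k ≡ + 0) → ev f v ≡ + 0
ev-zero f v f≗0 = sumℤ-zero _ (λ k → trans (cong (ℤ._* v k) (f≗0 k)) (ℤP.*-zeroˡ (v k)))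

ev-zero-head : ∀ {d} (f : Pt d) x v → ev (+ 0 ∷ f) (x ∷ v) ≡ ev f v
ev-zero-head f x v = trans (cong (ℤ._+ ev f v) (ℤP.*-zeroˡ x)) (ℤP.+-identityˡ (ev f v))

ev-on-zero-head : ∀ {d} (f : Pt (suc d)) v → ev f (+ 0 ∷ v) ≡ ev (tail f) v
ev-on-zero-head f v =
  trans (cong (ℤ._+ ev (tail f) v) (ℤP.*-zeroʳ (f zero))) (ℤP.+-identityˡ (ev (tail f) v))

≤-∣*∣ : ∀ i {j} → j ≢ + 0 → ℤ.∣ i ∣ ℕ.≤ ℤ.∣ j ℤ.* i ∣
≤-∣*∣ i {j} j≢0 = subst (ℤ.∣ i ∣ ℕ.≤_) (sym (ℤP.∣i*j∣≡∣i∣*∣j∣ j i))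
  (ℕP.m≤n*m ℤ.∣ i ∣ ℤ.∣ j ∣ {{ℕ.≢-nonZero (λ ∣j∣≡0 → j≢0 (ℤP.∣i∣≡0⇒i≡0 ∣j∣≡0))}})

module _ {d n : ℕ} (m : ℕ) (V : Fin (suc n) → Pt d) where

  private
    h : ℤ
    h = +[1+ m ]

  spread-pyramid-≥-spread-tail : ∀ f → spread V (tail f) ≤ spread (pyramid h V) f
  spread-pyramid-≥-spread-tail f =
    subst (_≤ spread (pyramid h V) f)
      (rangeℤ-cong (λ j → ev-on-zero-head f (V j)))
      (rangeℤ-tail-≤ (λ i → ev f (pyramid h V i)))

  spread-pyramid-vertical : ∀ f → (∀ k → tail f k ≡ + 0) → f zero ≢ + 0 →
                            + suc m ≤ spread (pyramid h V) f
  spread-pyramid-vertical f tail≗0 f₀≢0 =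
    ℤP.≤-trans (ℤ.+≤+ (≤-∣*∣ h f₀≢0))
      (subst (λ x → + ℤ.∣ x ∣ ≤ spread (pyramid h V) f) apex-base
        (∣-∣≤rangeℤ (λ i → ev f (pyramid h V i)) zero (suc zero)))
    where
    open ≡-Reasoning
    e : ev (tail f) (V zero) ≡ + 0
    e = ev-zero (tail f) (V zero) tail≗0
    apex-base : ev f (h ∷ V zero) ℤ.- ev f (+ 0 ∷ V zero) ≡ f zero ℤ.* h
    apex-base = begin
      (f zero ℤ.* h ℤ.+ ev (tail f) (V zero)) ℤ.- ev f (+ 0 ∷ V zero)
        ≡⟨ cong₂ (λ x y → (f zero ℤ.* h ℤ.+ x) ℤ.- y) e (trans (ev-on-zero-head f (V zero)) e) ⟩
      (f zero ℤ.* h ℤ.+ + 0) ℤ.- + 0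
        ≡⟨ trans (ℤP.+-identityʳ _) (ℤP.+-identityʳ _) ⟩
      f zero ℤ.* h ∎

  spread-pyramid-lift : ∀ f → spread (pyramid h V) (+ 0 ∷ f) ≡ spread V f
  spread-pyramid-lift f = trans
    (rangeℤ-cong {g = λ i → ev (+ 0 ∷ f) (pyramid h V i)} {h = ev f (V zero) ∷ λ j → ev f (V j)}
      λ { zero → ev-zero-head f h (V zero) ; (suc j) → ev-zero-head f (+ 0) (V j) })
    (rangeℤ-duplicate-head (λ j → ev f (V j)))

  pyramid-width : ∀ {w} → w ≤ + suc m → HasWidth V w → HasWidth (pyramid h V) w
  pyramid-width {w} w≤h ((f , f≢0 , spread≡w) , w≤spread) =
    (+ 0 ∷ f , (λ f′≗0 → f≢0 (λ k → f′≗0 (suc k))) , trans (spread-pyramid-lift f) spread≡w) ,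
    lower-bound
    where
    lower-bound : ∀ g → NonZeroFun g → w ≤ spread (pyramid h V) g
    lower-bound g g≢0 with all? (λ k → tail g k ℤ.≟ + 0)
    ... | no tail≢0 = ℤP.≤-trans (w≤spread (tail g) tail≢0) (spread-pyramid-≥-spread-tail g)
    ... | yes tail≗0 = ℤP.≤-trans w≤h (spread-pyramid-vertical g tail≗0
            (λ g₀≡0 → g≢0 λ { zero → g₀≡0 ; (suc k) → tail≗0 k }))

open +-*-Solver using (solve; _:+_; _:*_; _:-_; _:=_)

sumℚ-zero : ∀ {n} (g : Fin n → ℚ) → (∀ i → g i ≡ 0ℚ) → sumℚ g ≡ 0ℚ
sumℚ-zero {ℕ.zero} g g≗0 = refl
sumℚ-zero {suc n} g g≗0 = cong₂ ℚ._+_ (g≗0 zero) (sumℚ-zero (tail g) (λ i → g≗0 (suc i)))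

module _ {d n : ℕ} (h : ℤ) (V : Fin (suc n) → Pt d) where

  pyramid-conv-tail : ∀ y → InConv (pyramid h V) y → InConv V (tail y)
  pyramid-conv-tail y (μ , μ≥0 , Σμ≡1 , μV≡y) = ν , ν≥0 , trans (+-assoc (μ zero) (μ (suc zero)) (sumℚ (tail (tail μ)))) Σμ≡1 , νV≡y
    where
    +-assoc : ∀ p q r → (p ℚ.+ q) ℚ.+ r ≡ p ℚ.+ (q ℚ.+ r)
    +-assoc = solve 3 (λ p q r → (p :+ q) :+ r := p :+ (q :+ r)) refl
    +-*-distrib : ∀ p q a r → (p ℚ.+ q) ℚ.* a ℚ.+ r ≡ p ℚ.* a ℚ.+ (q ℚ.* a ℚ.+ r)
    +-*-distrib = solve 4 (λ p q a r → (p :+ q) :* a :+ r := p :* a :+ (q :* a :+ r)) refl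
    ν : Fin (suc n) → ℚ
    ν = (μ zero ℚ.+ μ (suc zero)) ∷ tail (tail μ)
    ν≥0 : ∀ i → 0ℚ ℚ.≤ ν i
    ν≥0 zero = ℚP.+-mono-≤ (μ≥0 zero) (μ≥0 (suc zero))
    ν≥0 (suc i) = μ≥0 (suc (suc i))
    νV≡y : ∀ k → sumℚ (λ i → ν i ℚ.* ℤtoℚ (V i k)) ≡ y (suc k)
    νV≡y k = trans (+-*-distrib (μ zero) (μ (suc zero)) (ℤtoℚ (V zero k)) (sumℚ (λ i → μ (suc (suc i)) ℚ.* ℤtoℚ (V (suc i) k))))
      (μV≡y (suc k))

  pyramid-hollow : Hollow V → Hollow (pyramid h V)
  pyramid-hollow V-hollow z (ε , ε>0 , ball⊆conv) =
    V-hollow (tail z) (ε , ε>0 , λ y y≈z → pyramid-conv-tail (z′ ∷ y) (ball⊆conv (z′ ∷ y) (near y y≈z)))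
    where
    z′ : ℚ
    z′ = ℤtoℚ (z zero)
    near : ∀ y → (∀ k → ℚ.∣ y k ℚ.- ℤtoℚ (z (suc k)) ∣ ℚ.< ε) →
           ∀ k → ℚ.∣ (z′ ∷ y) k ℚ.- ℤtoℚ (z k) ∣ ℚ.< ε
    near y y≈z zero = subst (λ x → ℚ.∣ x ∣ ℚ.< ε) (sym (ℚP.+-inverseʳ z′)) ε>0
    near y y≈z (suc k) = y≈z k

module _ {d n : ℕ} (m : ℕ) (V : Fin (suc n) → Pt d) where

  private
    h : ℤ
    h = +[1+ m ]
    q : ℚ
    q = mkℚ h 0 (Coprimality.sym (Coprimality.1-coprimeTo (suc m)))

    ÷h-*h : ∀ t → (t ℚ.÷ q) ℚ.* ℤtoℚ h ≡ t
    ÷h-*h t = begin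
      (t ℚ.÷ q) ℚ.* ℤtoℚ h ≡⟨ cong ((t ℚ.÷ q) ℚ.*_) (ℚP.normalize-coprime _) ⟩
      (t ℚ.* ℚ.1/ q) ℚ.* q ≡⟨ ℚP.*-assoc t (ℚ.1/ q) q ⟩
      t ℚ.* (ℚ.1/ q ℚ.* q) ≡⟨ cong (t ℚ.*_) (ℚP.*-inverseˡ q) ⟩
      t ℚ.* ℚ.1ℚ           ≡⟨ ℚP.*-identityʳ t ⟩
      t ∎
      where open ≡-Reasoning

  -- The apex receives weight y₀ / h, taken from the base copy of V 0.
  pyramid-fullDim : FullDim V → FullDim (pyramid h V)
  pyramid-fullDim V-full y with V-full (tail y)
  ... | λs , Σλ≡1 , λV≡y = μ , trans (shift-sum s (λs zero) (sumℚ (tail λs))) Σλ≡1 , μV≡y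
    where
    s : ℚ
    s = y zero ℚ.÷ q
    μ : Fin (suc (suc n)) → ℚ
    μ = s ∷ (λs zero ℚ.- s) ∷ tail λs
    shift-sum : ∀ s l r → s ℚ.+ ((l ℚ.- s) ℚ.+ r) ≡ l ℚ.+ r
    shift-sum = solve 3 (λ s l r → s :+ ((l :- s) :+ r) := l :+ r) refl
    shift-combination : ∀ s l a r → s ℚ.* a ℚ.+ ((l ℚ.- s) ℚ.* a ℚ.+ r) ≡ l ℚ.* a ℚ.+ r
    shift-combination = solve 4 (λ s l a r → s :* a :+ ((l :- s) :* a :+ r) := l :* a :+ r) refl
    μV≡y : ∀ k → sumℚ (λ i → μ i ℚ.* ℤtoℚ (pyramid h V i k)) ≡ y k
    μV≡y zero = begin
      s ℚ.* ℤtoℚ h ℚ.+ ((λs zero ℚ.- s) ℚ.* 0ℚ ℚ.+ sumℚ (λ i → λs (suc i) ℚ.* 0ℚ))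
        ≡⟨ cong₂ ℚ._+_ (÷h-*h (y zero))
             (cong₂ ℚ._+_ (ℚP.*-zeroʳ (λs zero ℚ.- s)) (sumℚ-zero _ (λ i → ℚP.*-zeroʳ (λs (suc i))))) ⟩
      y zero ℚ.+ (0ℚ ℚ.+ 0ℚ)
        ≡⟨ ℚP.+-identityʳ _ ⟩
      y zero ∎
      where open ≡-Reasoning
    μV≡y (suc k) = trans (shift-combination s (λs zero) (ℤtoℚ (V zero k)) (sumℚ (λ i → λs (suc i) ℚ.* ℤtoℚ (V (suc i) k))))
      (λV≡y k)

i≤+[1+∣i∣] : ∀ i → i ≤ + suc ℤ.∣ i ∣
i≤+[1+∣i∣] (+ n) = ℤ.+≤+ (ℕP.n≤1+n n)
i≤+[1+∣i∣] -[1+ n ] = ℤ.-≤+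

corollary7p2 : (d : ℕ) →
    (∀ (a b : ℤ) → IsWp d a → IsWp (suc d) b → a ≤ b) ×
    (∀ (a b : ℤ) → IsWs d a → IsWs (suc d) b → a ≤ b)
corollary7p2 d = wp , ws
  where
  module Lift {n} (a : ℤ) (V : Fin (suc n) → Pt d) where
    W : Fin (suc (suc n)) → Pt (suc d)
    W = pyramid +[1+ ℤ.∣ a ∣ ] V
    fullDim : FullDim V → FullDim W
    fullDim = pyramid-fullDim ℤ.∣ a ∣ V
    hollow : Hollow V → Hollow W
    hollow = pyramid-hollow +[1+ ℤ.∣ a ∣ ] V
    width : HasWidth V a → HasWidth W a
    width = pyramid-width ℤ.∣ a ∣ V (i≤+[1+∣i∣] a)

  wp : ∀ (a b : ℤ) → IsWp d a → IsWp (suc d) b → a ≤ b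
  wp a b (((n , V , V-full , V-hollow) , V-width) , _) (_ , b-max) =
    b-max (suc n , W , fullDim V-full , hollow V-hollow) a (width V-width)
    where open Lift a V
  ws : ∀ (a b : ℤ) → IsWs d a → IsWs (suc d) b → a ≤ b
  ws a b (((V , V-full , V-hollow) , V-width) , _) (_ , b-max) =
    b-max (W , fullDim V-full , hollow V-hollow) a (width V-width)
    where open Lift a V
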